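{- Let $\mathcal{S}$ be a locating-dominating set of the grid graph $G_{2,m}$. Suppose there is a $(2\times 4)$-block $\mathcal{B}$ of $G_{2,m}$ with vertex set $\{v_i, v_{i+1}, \dots, v_{i+7}\}$ such that $|\mathcal{B}\cap\mathcal{S}| = 2$. Then $i \neq 1$, $i+7 \neq 2m$, and $v_{i-2}, v_{i-1}, v_{i+8}, v_{i+9} \in \mathcal{S}$.
   Context: The grid graph $G_{2,m} = P_2 \square P_m$ has $2$ rows and $m$ columns; its vertices are labeled $v_1, \dots, v_{2m}$ so that column $j$ consists of $v_{2j-1}$ (top) and $v_{2j}$ (bottom). Edges join the two vertices of each column, and join $v_t$ and $v_{t+2}$ (same row, consecutive columns). A $(2\times 4)$-block is the set of vertices in $4$ consecutive columns, i.e. $\{v_i,\dots,v_{i+7}\}$ with $i$ odd. For $C \subseteq V(G)$ and a vertex $v$, let $I(v) := N[v]\cap C$, where $N[v]$ is the closed neighborhood. $C$ is a locating-dominating set if $I(v)\neq\emptyset$ for all $v\notin C$ and $I(u)\neq I(v)$ for all distinct $u,v \notin C$. -}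

module Defs where

open import Data.Nat using (ℕ; zero; suc; _+_; _*_; _∸_; _≤_; _<_)
open import Data.Nat.Properties using ()
open import Data.Bool using (Bool; true; false; if_then_else_)
open import Data.List using (List; upTo; map)
open import Data.Nat.ListAction using (sum)
open import Data.Product using (∃-syntax; _×_)
open import Data.Sum using (_⊎_)
open import Relation.Binary.PropositionalEquality using (_≡_; _≢_)
open import Relation.Nullary using (¬_)

-- Vertices of G_{2,m} are labelled v_1, ..., v_{2m}; we use the natural
-- number t (with 1 ≤ t ≤ 2m) for v_t.  Column j consists of v_{2j-1} (top)
-- and v_{2j} (bottom).

Odd : ℕ → Set
Odd t = ∃[ k ] (t ≡ 2 * k + 1)

IsVertex : ℕ → ℕ → Set
IsVertex m t = 1 ≤ t × t ≤ 2 * m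

Adj : ℕ → ℕ → Set
Adj u v = (Odd u × v ≡ u + 1) ⊎ (Odd v × u ≡ v + 1)
        ⊎ (v ≡ u + 2) ⊎ (u ≡ v + 2)

InClosedNbhd : ℕ → ℕ → ℕ → Set
InClosedNbhd m v w = IsVertex m w × (w ≡ v ⊎ Adj v w)

-- A vertex subset C ⊆ V(G_{2,m}) is given by its characteristic function
-- on labels (values outside 1..2m are irrelevant).
VSet : Set
VSet = ℕ → Bool

_∈S_ : ℕ → VSet → Set
t ∈S C = C t ≡ true

InI : ℕ → VSet → ℕ → ℕ → Set
InI m C v w = InClosedNbhd m v w × w ∈S C

record IsLocDom (m : ℕ) (C : VSet) : Set where
  field
    dominating : ∀ v → IsVertex m v → ¬ (v ∈S C) → ∃[ w ] InI m C v w
    locating   : ∀ u v → IsVertex m u → IsVertex m v → u ≢ v →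
                 ¬ (u ∈S C) → ¬ (v ∈S C) →
                 ¬ (∀ w → (InI m C u w → InI m C v w) × (InI m C v w → InI m C u w))

IsBlock : ℕ → ℕ → Set
IsBlock m i = Odd i × i + 7 ≤ 2 * m

blockCount : VSet → ℕ → ℕ
blockCount C i = sum (map (λ k → if C (i + k) then 1 else 0) (upTo 8))

-- The eight vertices of the block contain only two vertices of S, so the other
-- six need pairwise distinct, non-empty traces N[v] ∩ S. Every such trace lies
-- in the 2×6 window formed by the block and the columns on either side, and
-- inside the window the question is finite: among all 2^12 subsets of G_{2,6}
-- whose middle eight vertices are located and dominated with only two of them
-- in the set, every one contains the four outer vertices. A column missing at
-- the border of G_{2,m} behaves like an unoccupied column, so the same check
-- also shows that the block cannot touch either end of the grid.
module Submission where

open import Defs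
open import Data.Bool using (Bool; true; false; T; not; _∧_; _∨_; _xor_; if_then_else_)
open import Data.Bool.ListAction using (all; any)
open import Data.Bool.Properties using (T-∧; T-∨; T-≡)
open import Data.List using (List; applyUpTo; upTo; map)
open import Data.List.Properties using (map-cong-local)
open import Data.List.Relation.Unary.All.Properties using (applyUpTo⁺₁; all⁻)
open import Data.List.Relation.Unary.Any.Properties using (applyUpTo⁺; any⁺)
open import Data.Nat using (ℕ; zero; suc; _+_; _*_; _∸_; _≤_; _<_; _≤ᵇ_; _≡ᵇ_; z≤n; s≤s)
open import Data.Nat.ListAction using (sum)
open import Data.Nat.Properties
  using (_≟_; ≤-refl; ≤-reflexive; ≤-trans; ≤-pred; <⇒≤; ≤∧≢⇒<; m≤n⇒m≤1+n; 1+n≰n;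
         ≡ᵇ⇒≡; ≡⇒≡ᵇ; ≤ᵇ⇒≤; ≤⇒≤ᵇ; <ᵇ⇒<; +-assoc; +-comm; +-suc; *-suc; +-cancelʳ-≡;
         m≤m+n; m≤n+m; +-monoˡ-≤; +-monoʳ-≤; ∸-monoˡ-≤; +-∸-assoc; m∸n+n≡m; m+n∸n≡m;
         m∸n≢0⇒n<m; module ≤-Reasoning)
open import Data.Product using (_×_; _,_; proj₁; proj₂; ∃-syntax)
import Data.Product as Product
open import Data.Sum using (_⊎_; inj₁; inj₂)
import Data.Sum as Sum
open import Data.Unit using (tt)
open import Function.Base using (_∘_)
open import Function.Bundles using (module Equivalence)
open import Relation.Binary.PropositionalEquality
open import Relation.Nullary using (¬_; yes; no; contradiction)
open import Relation.Nullary.Decidable using (T?)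

open Equivalence using (to; from)

Near : ℕ → ℕ → Set
Near u w = w ≡ u ⊎ Adj u w

near : ℕ → ℕ → Bool
near (suc (suc u)) (suc (suc w)) = near u w
near 0 0 = true
near 0 2 = true
near 1 1 = true
near 1 2 = true
near 1 3 = true
near 2 0 = true
near 2 1 = true
near 3 1 = true
near _ _ = false

near-shift : ∀ k u w → near (2 * k + u) (2 * k + w) ≡ near u w
near-shift zero    u w = refl
near-shift (suc k) u w =
  trans (cong₂ near (cong (_+ u) (*-suc 2 k)) (cong (_+ w) (*-suc 2 k))) (near-shift k u w)

near-refl : ∀ u → T (near u u)
near-refl 0             = tt
near-refl 1             = tt
near-refl (suc (suc u)) = near-refl u

near-+2 : ∀ u → T (near u (u + 2))
near-+2 0             = tt
near-+2 1             = tt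
near-+2 (suc (suc u)) = near-+2 u

near-+2˘ : ∀ u → T (near (u + 2) u)
near-+2˘ 0             = tt
near-+2˘ 1             = tt
near-+2˘ (suc (suc u)) = near-+2˘ u

near-complete : ∀ {u w} → Near u w → T (near u w)
near-complete {u} (inj₁ refl) = near-refl u
near-complete (inj₂ (inj₁ ((k , refl) , refl))) =
  subst T (sym (trans (cong (near (2 * k + 1)) (+-assoc (2 * k) 1 1)) (near-shift k 1 2))) tt
near-complete (inj₂ (inj₂ (inj₁ ((k , refl) , refl)))) =
  subst T (sym (trans (cong (λ x → near x (2 * k + 1)) (+-assoc (2 * k) 1 1)) (near-shift k 2 1))) tt
near-complete {u} (inj₂ (inj₂ (inj₂ (inj₁ refl)))) = near-+2 u
near-complete {w = w} (inj₂ (inj₂ (inj₂ (inj₂ refl)))) = near-+2˘ w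

Odd-+2 : ∀ {u} → Odd u → Odd (2 + u)
Odd-+2 (k , refl) = suc k , cong (_+ 1) (sym (*-suc 2 k))

Near-+2 : ∀ {u w} → Near u w → Near (2 + u) (2 + w)
Near-+2 (inj₁ refl)                          = inj₁ refl
Near-+2 (inj₂ (inj₁ (o , refl)))             = inj₂ (inj₁ (Odd-+2 o , refl))
Near-+2 (inj₂ (inj₂ (inj₁ (o , refl))))      = inj₂ (inj₂ (inj₁ (Odd-+2 o , refl)))
Near-+2 (inj₂ (inj₂ (inj₂ (inj₁ refl))))     = inj₂ (inj₂ (inj₂ (inj₁ refl)))
Near-+2 (inj₂ (inj₂ (inj₂ (inj₂ refl))))     = inj₂ (inj₂ (inj₂ (inj₂ refl)))

near-sound : ∀ u w → T (near u w) → Near u w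
near-sound (suc (suc u)) (suc (suc w)) h = Near-+2 (near-sound u w h)
near-sound 0 0 _ = inj₁ refl
near-sound 0 2 _ = inj₂ (inj₂ (inj₂ (inj₁ refl)))
near-sound 1 1 _ = inj₁ refl
near-sound 1 2 _ = inj₂ (inj₁ ((0 , refl) , refl))
near-sound 1 3 _ = inj₂ (inj₂ (inj₂ (inj₁ refl)))
near-sound 2 0 _ = inj₂ (inj₂ (inj₂ (inj₂ refl)))
near-sound 2 1 _ = inj₂ (inj₂ (inj₁ ((0 , refl) , refl)))
near-sound 3 1 _ = inj₂ (inj₂ (inj₂ (inj₂ refl)))

Near⇒≤+2 : ∀ {u w} → Near u w → w ≤ u + 2 × u ≤ w + 2
Near⇒≤+2 {u} (inj₁ refl) = m≤m+n u 2 , m≤m+n u 2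
Near⇒≤+2 {u} (inj₂ (inj₁ (_ , refl))) =
  +-monoʳ-≤ u (s≤s z≤n) , ≤-trans (m≤m+n u 1) (m≤m+n (u + 1) 2)
Near⇒≤+2 {w = w} (inj₂ (inj₂ (inj₁ (_ , refl)))) =
  ≤-trans (m≤m+n w 1) (m≤m+n (w + 1) 2) , +-monoʳ-≤ w (s≤s z≤n)
Near⇒≤+2 {u} (inj₂ (inj₂ (inj₂ (inj₁ refl)))) =
  ≤-refl , ≤-trans (m≤m+n u 2) (m≤m+n (u + 2) 2)
Near⇒≤+2 {w = w} (inj₂ (inj₂ (inj₂ (inj₂ refl)))) =
  ≤-trans (m≤m+n w 2) (m≤m+n (w + 2) 2) , ≤-refl

-- Both labels move by i − 3, which is even since i is odd, so rows and columns
-- stay aligned.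
near-translate : ∀ {i} → Odd i → ∀ {d e} → 3 ≤ d + i → 3 ≤ e + i →
                 near (d + i ∸ 3) (e + i ∸ 3) ≡ near d e
near-translate {i} (k , refl) {d} {e} 3≤d+i 3≤e+i = begin
  near (d + i ∸ 3) (e + i ∸ 3)               ≡⟨⟩
  near (2 + (d + i ∸ 3)) (2 + (e + i ∸ 3))   ≡⟨ cong₂ near (unshift d 3≤d+i) (unshift e 3≤e+i) ⟩
  near (2 * k + d) (2 * k + e)               ≡⟨ near-shift k d e ⟩
  near d e                                   ∎
  where
  open ≡-Reasoning
  unshift : ∀ x → 3 ≤ x + i → 2 + (x + i ∸ 3) ≡ 2 * k + x
  unshift x h = begin
    2 + (x + i ∸ 3)   ≡⟨ +-∸-assoc 2 h ⟨
    2 + (x + i) ∸ 3   ≡⟨ cong (λ y → 2 + y ∸ 3)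
                            (trans (+-comm x (2 * k + 1)) (trans (+-assoc (2 * k) 1 x) (+-suc (2 * k) x))) ⟩
    2 * k + x         ∎

_[_≔_] : VSet → ℕ → Bool → VSet
(P [ n ≔ b ]) e = if e ≡ᵇ n then b else P e

restrict : ℕ → VSet → VSet
restrict zero    Q = λ _ → false
restrict (suc n) Q = restrict n Q [ suc n ≔ Q (suc n) ]

restrict-agrees : ∀ n Q {e} → 1 ≤ e → e ≤ n → restrict n Q e ≡ Q e
restrict-agrees zero    Q (s≤s _) ()
restrict-agrees (suc n) Q {e} 1≤e e≤1+n with e ≡ᵇ suc n in e≡ᵇ1+n
... | true  = cong Q (sym (≡ᵇ⇒≡ e (suc n) (from T-≡ e≡ᵇ1+n)))
... | false = restrict-agrees n Q 1≤e
                (≤-pred (≤∧≢⇒< e≤1+n λ { refl → subst T e≡ᵇ1+n (≡⇒≡ᵇ e e refl) }))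

every : ℕ → (VSet → Bool) → Bool
every zero    P = P (λ _ → false)
every (suc n) P = every n (λ R → P (R [ suc n ≔ true ])) ∧ every n (λ R → P (R [ suc n ≔ false ]))

every-sound : ∀ n P → T (every n P) → ∀ Q → T (P (restrict n Q))
every-sound zero    P h Q = h
every-sound (suc n) P h Q with Q (suc n)
... | true  = every-sound n _ (proj₁ (to T-∧ h)) Q
... | false = every-sound n _ (proj₂ (to T-∧ h)) Q

T-implies : ∀ {a b} → T (not a ∨ b) → T a → T b
T-implies {true} b _ = b

T-∧₄ : ∀ a b c {d} → T (a ∧ b ∧ c ∧ d) → T a × T b × T c × T d
T-∧₄ a b c = Product.map₂ (Product.map₂ (to (T-∧ {c})) ∘ to (T-∧ {b})) ∘ to (T-∧ {a})

T-∨₄ : ∀ a b c {d} → T a ⊎ T b ⊎ T c ⊎ T d → T (a ∨ b ∨ c ∨ d)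
T-∨₄ a b c = from (T-∨ {a}) ∘ Sum.map₂ (from (T-∨ {b}) ∘ Sum.map₂ (from (T-∨ {c})))

¬T-xor⇒≡ : ∀ x y → ¬ T (x xor y) → x ≡ y
¬T-xor⇒≡ false false _ = refl
¬T-xor⇒≡ false true  h = contradiction tt h
¬T-xor⇒≡ true  false h = contradiction tt h
¬T-xor⇒≡ true  true  _ = refl

-- P is a subset of G_{2,6} (labels 1..12); its middle labels 3..10 form the block.
windowLabels blockLabels : List ℕ
windowLabels = applyUpTo suc 12
blockLabels  = applyUpTo (3 +_) 8

dominatedᵇ : VSet → ℕ → Bool
dominatedᵇ P d = any (λ e → near d e ∧ P e) windowLabels

separatedᵇ : VSet → ℕ → ℕ → Bool
separatedᵇ P d d′ = any (λ e → P e ∧ (near d e xor near d′ e)) windowLabels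

distinguishedᵇ : VSet → ℕ → ℕ → Bool
distinguishedᵇ P d d′ = (d ≡ᵇ d′) ∨ P d ∨ P d′ ∨ separatedᵇ P d d′

blockLocDomᵇ : VSet → Bool
blockLocDomᵇ P = all (dominatedᵇ P) blockLabels ∧ all (λ d → all (distinguishedᵇ P d) blockLabels) blockLabels

blockSize : VSet → ℕ
blockSize P = sum (map (λ k → if P (3 + k) then 1 else 0) (upTo 8))

outerColumnsᵇ : VSet → Bool
outerColumnsᵇ P = P 1 ∧ P 2 ∧ P 11 ∧ P 12

sparseBlock⇒outerColumnsᵇ : VSet → Bool
sparseBlock⇒outerColumnsᵇ P = not ((blockSize P ≡ᵇ 2) ∧ blockLocDomᵇ P) ∨ outerColumnsᵇ P

-- Proved by evaluation: checking tt normalises every 12 … over all 2^12 subsets.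
sparseBlock⇒outerColumns : ∀ Q → let P = restrict 12 Q in
                           blockSize P ≡ 2 → T (blockLocDomᵇ P) → T (outerColumnsᵇ P)
sparseBlock⇒outerColumns Q size≡2 locDom =
  T-implies (every-sound 12 sparseBlock⇒outerColumnsᵇ tt Q) (from T-∧ (≡⇒≡ᵇ _ 2 size≡2 , locDom))

Odd⇒1≤ : ∀ {n} → Odd n → 1 ≤ n
Odd⇒1≤ (k , refl) = m≤n+m 1 (2 * k)

I-nonempty : ∀ {m S v} → IsLocDom m S → IsVertex m v → ∃[ w ] InI m S v w
I-nonempty {S = S} {v} locDom v-vertex with S v in v∈S
... | true  = v , (v-vertex , inj₁ refl) , v∈S
... | false = IsLocDom.dominating locDom v v-vertex λ v∈S′ → contradiction (trans (sym v∈S) v∈S′) λ ()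

Occupied : ℕ → VSet → ℕ → Set
Occupied m S t = IsVertex m t × t ∈S S

occupiedᵇ : ℕ → VSet → ℕ → Bool
occupiedᵇ m S t = (1 ≤ᵇ t) ∧ (t ≤ᵇ 2 * m) ∧ S t

occupiedᵇ-sound : ∀ {m S t} → T (occupiedᵇ m S t) → Occupied m S t
occupiedᵇ-sound {m} {S} {t} h with to T-∧ h
... | 1≤t , h′ with to T-∧ h′
... | t≤2m , t∈S = (≤ᵇ⇒≤ 1 t 1≤t , ≤ᵇ⇒≤ t (2 * m) t≤2m) , to T-≡ t∈S

occupiedᵇ-vertex : ∀ {m S t} → IsVertex m t → occupiedᵇ m S t ≡ S t
occupiedᵇ-vertex (1≤t , t≤2m) rewrite to T-≡ (≤⇒≤ᵇ 1≤t) | to T-≡ (≤⇒≤ᵇ t≤2m) = refl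

-- Window label e stands for the vertex v_{e+i-3}, so the block starting at v_i
-- has labels 3..10. Labels that are not vertices of G_{2,m} (including the junk
-- value 0 produced by ∸ when i = 1) are unoccupied.
windowAt : ℕ → ℕ → ℕ
windowAt i e = e + i ∸ 3

occupancy : ℕ → VSet → ℕ → VSet
occupancy m S i e = occupiedᵇ m S (windowAt i e)

window : ℕ → VSet → ℕ → VSet
window m S i = restrict 12 (occupancy m S i)

module _ {m : ℕ} {S : VSet} (locDom : IsLocDom m S)
         {i : ℕ} (odd-i : Odd i) (block-fits : i + 7 ≤ 2 * m) where

  open IsLocDom locDom

  W : VSet
  W = window m S i

  window-agrees : ∀ {j} → j < 12 → W (suc j) ≡ occupiedᵇ m S (windowAt i (suc j))
  window-agrees = restrict-agrees 12 (occupancy m S i) (s≤s z≤n)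

  window-sound : ∀ {j} → j < 12 → T (W (suc j)) → Occupied m S (windowAt i (suc j))
  window-sound j<12 h = occupiedᵇ-sound {m} {S} (subst T (window-agrees j<12) h)

  window-complete : ∀ {j} → j < 12 → Occupied m S (windowAt i (suc j)) → T (W (suc j))
  window-complete j<12 (vertex , ∈S) =
    from T-≡ (trans (window-agrees j<12) (trans (occupiedᵇ-vertex {m} {S} vertex) ∈S))

  block-vertex : ∀ {k} → k < 8 → IsVertex m (k + i)
  block-vertex {k} (s≤s k≤7) =
    ≤-trans (Odd⇒1≤ odd-i) (m≤n+m i k) ,
    ≤-trans (+-monoˡ-≤ i k≤7) (≤-trans (≤-reflexive (+-comm 7 i)) block-fits)

  window-block : ∀ {k} → k < 8 → W (3 + k) ≡ S (k + i)
  window-block {k} k<8 = trans (window-agrees {2 + k} (m≤n⇒m≤1+n (+-monoʳ-≤ 3 (<⇒≤ k<8))))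
                           (occupiedᵇ-vertex {m} {S} (block-vertex k<8))

  blockSize-window : blockSize W ≡ blockCount S i
  blockSize-window = cong sum (map-cong-local (applyUpTo⁺₁ (λ k → k) 8 λ {k} k<8 →
    cong (λ b → if b then 1 else 0) (trans (window-block k<8) (cong S (+-comm k i)))))

  toWindow : ∀ {k w} → k < 8 → InI m S (k + i) w →
             ∃[ j ] j < 12 × w ≡ windowAt i (suc j) × T (near (3 + k) (suc j) ∧ W (suc j))
  toWindow {k} {w} k<8 ((w-vertex , near-w) , w∈S) =
    j , j<12 , sym at-j≡w , from T-∧ (near-j , W-j)
    where
    open ≤-Reasoning
    j : ℕ
    j = w + 2 ∸ i
    j+i≡w+2 : j + i ≡ w + 2
    j+i≡w+2 = m∸n+n≡m (≤-trans (m≤n+m i k) (proj₂ (Near⇒≤+2 near-w)))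
    at-j≡w : windowAt i (suc j) ≡ w
    at-j≡w = trans (cong (_∸ 2) j+i≡w+2) (m+n∸n≡m w 2)
    j<12 : j < 12
    j<12 = begin-strict
      w + 2 ∸ i          ≤⟨ ∸-monoˡ-≤ i (+-monoˡ-≤ 2 (proj₁ (Near⇒≤+2 near-w))) ⟩
      k + i + 2 + 2 ∸ i  ≡⟨ cong (_∸ i) (trans (+-assoc (k + i) 2 2) (+-comm (k + i) 4)) ⟩
      4 + k + i ∸ i      ≡⟨ m+n∸n≡m (4 + k) i ⟩
      4 + k              <⟨ +-monoʳ-≤ 4 k<8 ⟩
      12                 ∎
    near-j : T (near (3 + k) (suc j))
    near-j = subst T (near-translate odd-i (m≤m+n 3 (k + i))
                                     (subst (3 ≤_) (cong suc (sym j+i≡w+2)) (s≤s (m≤n+m 2 w))))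
                     (subst (T ∘ near (k + i)) (sym at-j≡w) (near-complete near-w))
    W-j : T (W (suc j))
    W-j = window-complete j<12 (subst (Occupied m S) (sym at-j≡w) (w-vertex , w∈S))

  fromWindow : ∀ {k j} → j < 12 → T (near (3 + k) (suc j) ∧ W (suc j)) →
               InI m S (k + i) (windowAt i (suc j))
  fromWindow {k} {j} j<12 h with to T-∧ h
  ... | near-j , W-j with window-sound j<12 W-j
  ... | vertex@(1≤at , _) , at∈S =
    (vertex , near-sound _ _ (subst T (sym (near-translate odd-i (m≤m+n 3 (k + i)) 3≤)) near-j)) , at∈S
    where
    3≤ : 3 ≤ suc j + i
    3≤ = <⇒≤ (m∸n≢0⇒n<m λ at≡0 → contradiction (subst (1 ≤_) at≡0 1≤at) λ ())

  dominated-window : ∀ {k} → k < 8 → T (dominatedᵇ W (3 + k))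
  dominated-window {k} k<8 with I-nonempty locDom (block-vertex k<8)
  ... | w , w∈I with toWindow k<8 w∈I
  ... | j , j<12 , _ , h = any⁺ (λ e → near (3 + k) e ∧ W e) (applyUpTo⁺ suc h j<12)

  SameTrace : ℕ → ℕ → Set
  SameTrace d d′ = ∀ {j} → j < 12 → T (W (suc j)) → near d (suc j) ≡ near d′ (suc j)

  unseparated⇒sameTrace : ∀ {d d′} → ¬ T (separatedᵇ W d d′) → SameTrace d d′
  unseparated⇒sameTrace {d} {d′} ¬sep j<12 W-j = ¬T-xor⇒≡ _ _ λ differ →
    ¬sep (any⁺ (λ e → W e ∧ (near d e xor near d′ e)) (applyUpTo⁺ suc (from T-∧ (W-j , differ)) j<12))

  sameTrace⇒I⊆ : ∀ {k k′} → k < 8 → SameTrace (3 + k) (3 + k′) →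
                 ∀ w → InI m S (k + i) w → InI m S (k′ + i) w
  sameTrace⇒I⊆ k<8 same w w∈I with toWindow k<8 w∈I
  ... | j , j<12 , refl , h with to T-∧ h
  ... | near-j , W-j = fromWindow j<12 (from T-∧ (subst T (same j<12 W-j) near-j , W-j))

  distinction : ∀ {k k′} → k < 8 → k′ < 8 →
                T (3 + k ≡ᵇ 3 + k′) ⊎ T (W (3 + k)) ⊎ T (W (3 + k′)) ⊎ T (separatedᵇ W (3 + k) (3 + k′))
  distinction {k} {k′} k<8 k′<8 with k ≟ k′
  ... | yes refl = inj₁ (≡⇒≡ᵇ (3 + k) (3 + k) refl)
  ... | no k≢k′ with S (k + i) in k∈S | S (k′ + i) in k′∈S | T? (separatedᵇ W (3 + k) (3 + k′))
  ... | true  | _     | _       = inj₂ (inj₁ (from T-≡ (trans (window-block k<8) k∈S)))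
  ... | false | true  | _       = inj₂ (inj₂ (inj₁ (from T-≡ (trans (window-block k′<8) k′∈S))))
  ... | false | false | yes sep = inj₂ (inj₂ (inj₂ sep))
  ... | false | false | no ¬sep = contradiction
          (λ w → sameTrace⇒I⊆ k<8 same w , sameTrace⇒I⊆ k′<8 (λ j<12 W-j → sym (same j<12 W-j)) w)
          (locating (k + i) (k′ + i) (block-vertex k<8) (block-vertex k′<8) (k≢k′ ∘ +-cancelʳ-≡ i k k′)
                    (λ k∈S′ → contradiction (trans (sym k∈S) k∈S′) λ ())
                    (λ k′∈S′ → contradiction (trans (sym k′∈S) k′∈S′) λ ()))
    where
    same : SameTrace (3 + k) (3 + k′)
    same = unseparated⇒sameTrace {3 + k} {3 + k′} ¬sep

  blockLocDom-window : T (blockLocDomᵇ W)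
  blockLocDom-window = from T-∧
    ( all⁻ (dominatedᵇ W) (applyUpTo⁺₁ (3 +_) 8 dominated-window)
    , all⁻ (λ d → all (distinguishedᵇ W d) blockLabels) (applyUpTo⁺₁ (3 +_) 8 λ {k} k<8 →
        all⁻ (distinguishedᵇ W (3 + k)) (applyUpTo⁺₁ (3 +_) 8 λ k′<8 → T-∨₄ _ _ _ (distinction k<8 k′<8))))

  outer-occupied : blockCount S i ≡ 2 →
                   Occupied m S (i ∸ 2) × Occupied m S (i ∸ 1) × Occupied m S (8 + i) × Occupied m S (9 + i)
  outer-occupied count≡2 =
    let W₁ , W₂ , W₁₁ , W₁₂ = T-∧₄ (W 1) (W 2) (W 11)
          (sparseBlock⇒outerColumns (occupancy m S i) (trans blockSize-window count≡2) blockLocDom-window)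
    in window-sound (<ᵇ⇒< 0 12 tt) W₁ , window-sound (<ᵇ⇒< 1 12 tt) W₂ ,
       window-sound (<ᵇ⇒< 10 12 tt) W₁₁ , window-sound (<ᵇ⇒< 11 12 tt) W₁₂

lemma4p4 : (m : ℕ) (S : VSet) → IsLocDom m S →
           (i : ℕ) → IsBlock m i → blockCount S i ≡ 2 →
           (i ≢ 1) × (i + 7 ≢ 2 * m) ×
           ((i ∸ 2) ∈S S) × ((i ∸ 1) ∈S S) × ((i + 8) ∈S S) × ((i + 9) ∈S S)
lemma4p4 m S locDom i (odd-i , block-fits) count≡2 =
  let ((1≤i∸2 , _) , i∸2∈S) , (_ , i∸1∈S) , ((_ , 8+i≤2m) , 8+i∈S) , (_ , 9+i∈S) =
        outer-occupied locDom odd-i block-fits count≡2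
  in (λ { refl → contradiction 1≤i∸2 λ () }) ,
     (λ i+7≡2m → 1+n≰n (subst (8 + i ≤_) (trans (sym i+7≡2m) (+-comm i 7)) 8+i≤2m)) ,
     i∸2∈S , i∸1∈S , subst (_∈S S) (+-comm 8 i) 8+i∈S , subst (_∈S S) (+-comm 9 i) 9+i∈S
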